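{- Let $R$ be injective and univalent and let $p$ be a point such that $p\mathbin{;}R\subseteq R^*\cup R^{\top*}$ and $R\mathbin{;}p=\mathsf{O}$. Then $R$ is acyclic, i.e. $R^+\subseteq\overline{\mathsf{I}}$.
   Context: $(B,\cup,\mathbin{;},\overline{\,\cdot\,},{}^{\top},{}^{*},\mathsf{I})$ is a Kleene relation algebra; all variables range over $B$. That is, $(B,\cup,\mathbin{;},\overline{\,\cdot\,},{}^{\top},\mathsf{I})$ is a relation algebra: $\cup$ is associative and commutative and $R=\overline{\overline{R}\cup\overline{S}}\cup\overline{\overline{R}\cup S}$; $\mathbin{;}$ is associative, $(R\cup S)\mathbin{;}T=R\mathbin{;}T\cup S\mathbin{;}T$, $R\mathbin{;}\mathsf{I}=R$; $(R^{\top})^{\top}=R$, $(R\cup S)^{\top}=R^{\top}\cup S^{\top}$, $(R\mathbin{;}S)^{\top}=S^{\top}\mathbin{;}R^{\top}$; $R^{\top}\mathbin{;}\overline{R\mathbin{;}S}\cup\overline{S}=\overline{S}$. The order is $R\subseteq S$ iff $R\cup S=S$; $R\cap S=\overline{\overline{R}\cup\overline{S}}$; $\mathsf{L}=R\cup\overline{R}$ is the greatest and $\mathsf{O}=R\cap\overline{R}$ the least element. The star satisfies $\mathsf{I}\cup R\mathbin{;}R^*\subseteq R^*$, $\mathsf{I}\cup R^*\mathbin{;}R\subseteq R^*$, $S\cup R\mathbin{;}Q\subseteq Q\Rightarrow R^*\mathbin{;}S\subseteq Q$, $S\cup Q\mathbin{;}R\subseteq Q\Rightarrow S\mathbin{;}R^*\subseteq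 Q$. Write $R^+=R\mathbin{;}R^*$ and $R^{\top*}=(R^{\top})^*$. The algebra satisfies the Tarski rule ($R\neq\mathsf{O}$ iff $\mathsf{L}\mathbin{;}R\mathbin{;}\mathsf{L}=\mathsf{L}$) and the point axiom (for every $R\neq\mathsf{O}$ there are points $p,q$ with $p\mathbin{;}q^{\top}\subseteq R$). A point is an element $p$ with $p=p\mathbin{;}\mathsf{L}$, $p\mathbin{;}p^{\top}\subseteq\mathsf{I}$ and $\mathsf{I}\subseteq p^{\top}\mathbin{;}p$. Composition binds tighter than $\cup,\cap$; complement and converse bind tighter than composition. $R$ is univalent if $R^{\top}\mathbin{;}R\subseteq\mathsf{I}$ and injective if $R\mathbin{;}R^{\top}\subseteq\mathsf{I}$. -}

module Defs where

open import Level using (Level; suc)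
open import Relation.Binary.PropositionalEquality using (_≡_)
open import Relation.Nullary using (¬_)
open import Data.Product using (Σ; _×_)
open import Function.Bundles using (_⇔_)

record KleeneRelationAlgebra (c : Level) : Set (suc c) where
  infixl 6 _∪_ _∩_
  infixl 7 _⨾_
  infix  9 ~_ _ᵀ _*
  infix  4 _⊆_
  field
    B    : Set c
    _∪_  : B → B → B
    _⨾_  : B → B → B
    ~_   : B → B
    _ᵀ   : B → B
    _*   : B → B
    I    : B

  _⊆_ : B → B → Set c
  R ⊆ S = R ∪ S ≡ S

  _∩_ : B → B → B
  R ∩ S = ~ (~ R ∪ ~ S)

  L : B
  L = I ∪ ~ I

  O : B
  O = I ∩ ~ I

  IsPoint : B → Set c
  IsPoint p = (p ≡ p ⨾ L) × (p ⨾ p ᵀ ⊆ I) × (I ⊆ p ᵀ ⨾ p)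

  field
    ∪-assoc   : ∀ R S T → (R ∪ S) ∪ T ≡ R ∪ (S ∪ T)
    ∪-comm    : ∀ R S → R ∪ S ≡ S ∪ R
    huntington : ∀ R S → R ≡ ~ (~ R ∪ ~ S) ∪ ~ (~ R ∪ S)
    ⨾-assoc   : ∀ R S T → (R ⨾ S) ⨾ T ≡ R ⨾ (S ⨾ T)
    ⨾-distribʳ : ∀ R S T → (R ∪ S) ⨾ T ≡ R ⨾ T ∪ S ⨾ T
    ⨾-identityʳ : ∀ R → R ⨾ I ≡ R
    ᵀ-involutive : ∀ R → (R ᵀ) ᵀ ≡ R
    ᵀ-∪ : ∀ R S → (R ∪ S) ᵀ ≡ R ᵀ ∪ S ᵀ
    ᵀ-⨾ : ∀ R S → (R ⨾ S) ᵀ ≡ S ᵀ ⨾ R ᵀ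
    schroeder : ∀ R S → R ᵀ ⨾ ~ (R ⨾ S) ∪ ~ S ≡ ~ S
    star-unfoldˡ : ∀ R → I ∪ R ⨾ R * ⊆ R *
    star-unfoldʳ : ∀ R → I ∪ R * ⨾ R ⊆ R *
    star-inductˡ : ∀ R S Q → S ∪ R ⨾ Q ⊆ Q → R * ⨾ S ⊆ Q
    star-inductʳ : ∀ R S Q → S ∪ Q ⨾ R ⊆ Q → S ⨾ R * ⊆ Q
    tarski : ∀ R → (¬ (R ≡ O)) ⇔ (L ⨾ R ⨾ L ≡ L)
    point-axiom : ∀ R → ¬ (R ≡ O) →
      Σ B (λ p → Σ B (λ q → IsPoint p × IsPoint q × (p ⨾ q ᵀ ⊆ R)))

  infix 9 _⁺
  _⁺ : B → B
  R ⁺ = R ⨾ R *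

  Univalent : B → Set c
  Univalent R = R ᵀ ⨾ R ⊆ I

  Injective : B → Set c
  Injective R = R ⨾ R ᵀ ⊆ I

-- Let C = (R ⁺ ∩ I) ⨾ L be the vector of points lying on an R-cycle.  Every
-- such point has an R-predecessor, so C lies in the range R ᵀ ⨾ L of R, and by
-- injectivity that predecessor is on the same cycle: R ⨾ C ⊆ C, which by
-- Schröder's rule says that R-successors of points outside C stay outside C.
-- Since R ⨾ p = O, the point p is outside the range of R, hence outside C, so
-- everything R-reachable from p avoids C.  The hypothesis on p ⨾ R makes the
-- whole range of R reachable from p, hence C ⊆ ~ C and C = O.
module Submission where

open import Defs
open import Level using (Level; suc)
open import Data.Product using (_,_)
open import Function using (_∘_)
open import Algebra.Core using (Op₁; Op₂)
open import Algebra.Definitions using (Associative; Commutative)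
open import Algebra.Bundles using (CommutativeSemigroup)
import Algebra.Properties.CommutativeSemigroup as CommutativeSemigroupProperties
open import Relation.Binary.Core using (Rel)
open import Relation.Binary.Structures using (IsPreorder)
open import Relation.Binary.PropositionalEquality
  using (_≡_; refl; sym; trans; cong; cong₂; subst; subst₂; isEquivalence; module ≡-Reasoning)
import Relation.Binary.Reasoning.Base.Double as DoubleReasoning
open import Relation.Binary.Reasoning.Syntax using (module ⊆-syntax)

record HuntingtonAlgebra a : Set (suc a) where
  infixl 6 _∪_
  infix  9 ~_
  field
    Carrier    : Set a
    _∪_        : Op₂ Carrier
    ~_         : Op₁ Carrier
    ∪-assoc    : Associative _≡_ _∪_
    ∪-comm     : Commutative _≡_ _∪_
    huntington : ∀ x y → x ≡ ~ (~ x ∪ ~ y) ∪ ~ (~ x ∪ y)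

-- Any element e gives the top e ∪ ~ e; by x∪~x≡y∪~y the choice of e does
-- not matter.
module HuntingtonAlgebraProperties {a} (H : HuntingtonAlgebra a) (e : HuntingtonAlgebra.Carrier H) where
  open HuntingtonAlgebra H renaming (Carrier to A)

  infixl 6 _∩_
  infix  4 _⊆_

  _∩_ : Op₂ A
  x ∩ y = ~ (~ x ∪ ~ y)

  ⊤ ⊥ : A
  ⊤ = e ∪ ~ e
  ⊥ = e ∩ ~ e

  ∪-commutativeSemigroup : CommutativeSemigroup a a
  ∪-commutativeSemigroup = record
    { isCommutativeSemigroup = record
      { isSemigroup = record
        { isMagma = record { isEquivalence = isEquivalence ; ∙-cong = cong₂ _∪_ }
        ; assoc   = ∪-assoc
        }
      ; comm = ∪-comm
      }
    }

  open CommutativeSemigroupProperties ∪-commutativeSemigroup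
    using (interchange)

  open ≡-Reasoning

  x∪~x≡~x∪~~x : ∀ x → x ∪ ~ x ≡ ~ x ∪ ~ ~ x
  x∪~x≡~x∪~~x x = begin
    x ∪ ~ x                ≡⟨ cong₂ _∪_ (huntington x (~ ~ x)) (huntington (~ x) (~ ~ x)) ⟩
    (tA ∪ tB) ∪ (tC ∪ tD)  ≡⟨ interchange tA tB tC tD ⟩
    (tA ∪ tC) ∪ (tB ∪ tD)  ≡⟨ cong₂ _∪_ (∪-comm tA tC) (∪-comm tB tD) ⟩
    (tC ∪ tA) ∪ (tD ∪ tB)  ≡⟨ ∪-comm _ _ ⟩
    (tD ∪ tB) ∪ (tC ∪ tA)  ≡⟨ cong₂ _∪_ (cong (tD ∪_) (cong ~_ (∪-comm _ _)))
                                      (cong₂ _∪_ (cong ~_ (∪-comm _ _)) (cong ~_ (∪-comm _ _))) ⟨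
    (tD ∪ ~ (~ ~ x ∪ ~ x)) ∪ (~ (~ ~ ~ x ∪ ~ ~ x) ∪ ~ (~ ~ ~ x ∪ ~ x))
                           ≡⟨ cong₂ _∪_ (huntington (~ x) (~ x)) (huntington (~ ~ x) (~ x)) ⟨
    ~ x ∪ ~ ~ x            ∎
    where
    tA tB tC tD : A
    tA = ~ (~ x ∪ ~ ~ ~ x)
    tB = ~ (~ x ∪ ~ ~ x)
    tC = ~ (~ ~ x ∪ ~ ~ ~ x)
    tD = ~ (~ ~ x ∪ ~ ~ x)

  ~-involutive : ∀ x → ~ ~ x ≡ x
  ~-involutive x = begin
    ~ ~ x                                      ≡⟨ huntington (~ ~ x) (~ x) ⟩
    ~ (~ ~ ~ x ∪ ~ ~ x) ∪ ~ (~ ~ ~ x ∪ ~ x)    ≡⟨ cong₂ _∪_ (cong ~_ (trans (∪-comm _ _) (sym (x∪~x≡~x∪~~x (~ x)))))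
                                                           (cong ~_ (∪-comm _ _)) ⟩
    ~ (~ x ∪ ~ ~ x) ∪ ~ (~ x ∪ ~ ~ ~ x)        ≡⟨ ∪-comm _ _ ⟩
    ~ (~ x ∪ ~ ~ ~ x) ∪ ~ (~ x ∪ ~ ~ x)        ≡⟨ huntington x (~ ~ x) ⟨
    x                                          ∎

  huntington-~ : ∀ x y → ~ x ≡ ~ (x ∪ ~ y) ∪ ~ (x ∪ y)
  huntington-~ x y = begin
    ~ x                                    ≡⟨ huntington (~ x) y ⟩
    ~ (~ ~ x ∪ ~ y) ∪ ~ (~ ~ x ∪ y)        ≡⟨ cong (λ z → ~ (z ∪ ~ y) ∪ ~ (z ∪ y)) (~-involutive x) ⟩
    ~ (x ∪ ~ y) ∪ ~ (x ∪ y)                ∎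

  x∪~x≡y∪~y : ∀ x y → x ∪ ~ x ≡ y ∪ ~ y
  x∪~x≡y∪~y x y = begin
    x ∪ ~ x                                                    ≡⟨ cong₂ _∪_ (huntington x y) (huntington-~ x y) ⟩
    (~ (~ x ∪ ~ y) ∪ ~ (~ x ∪ y)) ∪ (~ (x ∪ ~ y) ∪ ~ (x ∪ y))  ≡⟨ interchange _ _ _ _ ⟩
    (~ (~ x ∪ ~ y) ∪ ~ (x ∪ ~ y)) ∪ (~ (~ x ∪ y) ∪ ~ (x ∪ y))  ≡⟨ cong₂ _∪_ (cong₂ _∪_ (cong ~_ (∪-comm _ _)) (cong ~_ (∪-comm _ _)))
                                                                          (cong₂ _∪_ (cong ~_ (∪-comm _ _)) (cong ~_ (∪-comm _ _))) ⟩
    (~ (~ y ∪ ~ x) ∪ ~ (~ y ∪ x)) ∪ (~ (y ∪ ~ x) ∪ ~ (y ∪ x))  ≡⟨ cong₂ _∪_ (huntington y x) (huntington-~ y x) ⟨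
    y ∪ ~ y                                                    ∎

  -- Writing z = ~ c and splitting c by Huntington, ⊤ ∪ ⊤ is a regrouping of
  -- the five terms (c ∪ ~ c) ∪ (c ∪ ~ c) ∪ ~ c.
  ⊤∪⊤-zeroʳ : ∀ z → (⊤ ∪ ⊤) ∪ z ≡ ⊤ ∪ ⊤
  ⊤∪⊤-zeroʳ z = sym (begin
    ⊤ ∪ ⊤                                ≡⟨ cong₂ _∪_ (x∪~x≡y∪~y e u) (x∪~x≡y∪~y e v) ⟩
    (u ∪ ~ u) ∪ (v ∪ ~ v)                ≡⟨ interchange u (~ u) v (~ v) ⟩
    (u ∪ v) ∪ (~ u ∪ ~ v)                ≡⟨ cong₂ _∪_ (huntington c c) (cong₂ _∪_ (sym (~-involutive _)) (sym (~-involutive _))) ⟨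
    c ∪ ((~ c ∪ ~ c) ∪ (~ c ∪ c))        ≡⟨ cong (c ∪_) (∪-comm _ _) ⟩
    c ∪ ((~ c ∪ c) ∪ (~ c ∪ ~ c))        ≡⟨ ∪-assoc _ _ _ ⟨
    (c ∪ (~ c ∪ c)) ∪ (~ c ∪ ~ c)        ≡⟨ cong (_∪ (~ c ∪ ~ c)) (∪-assoc _ _ _) ⟨
    ((c ∪ ~ c) ∪ c) ∪ (~ c ∪ ~ c)        ≡⟨ interchange _ _ _ _ ⟩
    ((c ∪ ~ c) ∪ ~ c) ∪ (c ∪ ~ c)        ≡⟨ ∪-assoc _ _ _ ⟩
    (c ∪ ~ c) ∪ (~ c ∪ (c ∪ ~ c))        ≡⟨ cong ((c ∪ ~ c) ∪_) (∪-comm _ _) ⟩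
    (c ∪ ~ c) ∪ ((c ∪ ~ c) ∪ ~ c)        ≡⟨ ∪-assoc _ _ _ ⟨
    ((c ∪ ~ c) ∪ (c ∪ ~ c)) ∪ ~ c        ≡⟨ cong₂ _∪_ (cong₂ _∪_ (x∪~x≡y∪~y c e) (x∪~x≡y∪~y c e)) (~-involutive z) ⟩
    (⊤ ∪ ⊤) ∪ z                          ∎)
    where
    c u v : A
    c = ~ z
    u = ~ (~ c ∪ ~ c)
    v = ~ (~ c ∪ c)

  ⊤∪⊤≡⊤ : ⊤ ∪ ⊤ ≡ ⊤
  ⊤∪⊤≡⊤ = sym (begin
    ⊤                    ≡⟨ x∪~x≡y∪~y e w ⟩
    w ∪ ~ w              ≡⟨ cong (w ∪_) (~-involutive _) ⟩
    w ∪ (⊤ ∪ ⊤)          ≡⟨ ∪-comm _ _ ⟩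
    (⊤ ∪ ⊤) ∪ w          ≡⟨ ⊤∪⊤-zeroʳ w ⟩
    ⊤ ∪ ⊤                ∎)
    where
    w : A
    w = ~ (⊤ ∪ ⊤)

  ∪-zeroˡ : ∀ x → ⊤ ∪ x ≡ ⊤
  ∪-zeroˡ x = begin
    ⊤ ∪ x                ≡⟨ cong (_∪ x) ⊤∪⊤≡⊤ ⟨
    (⊤ ∪ ⊤) ∪ x          ≡⟨ ⊤∪⊤-zeroʳ x ⟩
    ⊤ ∪ ⊤                ≡⟨ ⊤∪⊤≡⊤ ⟩
    ⊤                    ∎

  ⊥≡~⊤ : ⊥ ≡ ~ ⊤
  ⊥≡~⊤ = cong ~_ (x∪~x≡y∪~y (~ e) e)

  ~x∪~~x≡⊤ : ∀ x → ~ x ∪ ~ ~ x ≡ ⊤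
  ~x∪~~x≡⊤ x = x∪~x≡y∪~y (~ x) e

  ~⊥≡⊤ : ~ ⊥ ≡ ⊤
  ~⊥≡⊤ = trans (~-involutive _) (~x∪~~x≡⊤ e)

  ⊥∪⊥≡⊥ : ⊥ ∪ ⊥ ≡ ⊥
  ⊥∪⊥≡⊥ = begin
    ⊥ ∪ ⊥                            ≡⟨ cong₂ _∪_ ⊥≡~⊤ ⊥≡~⊤ ⟩
    ~ ⊤ ∪ ~ ⊤                        ≡⟨ cong₂ _∪_ (cong ~_ (∪-zeroˡ _)) (cong ~_ (∪-zeroˡ _)) ⟨
    ~ (⊤ ∪ ~ ~ ⊤) ∪ ~ (⊤ ∪ ~ ⊤)      ≡⟨ huntington-~ ⊤ (~ ⊤) ⟨
    ~ ⊤                              ≡⟨ ⊥≡~⊤ ⟨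
    ⊥                                ∎

  ∪-identityʳ : ∀ x → x ∪ ⊥ ≡ x
  ∪-identityʳ x = begin
    x ∪ ⊥                ≡⟨ cong (_∪ ⊥) x≡u∪⊥ ⟩
    (u ∪ ⊥) ∪ ⊥          ≡⟨ ∪-assoc _ _ _ ⟩
    u ∪ (⊥ ∪ ⊥)          ≡⟨ cong (u ∪_) ⊥∪⊥≡⊥ ⟩
    u ∪ ⊥                ≡⟨ x≡u∪⊥ ⟨
    x                    ∎
    where
    u : A
    u = ~ (~ x ∪ ~ x)
    x≡u∪⊥ : x ≡ u ∪ ⊥
    x≡u∪⊥ = begin
      x                        ≡⟨ huntington x x ⟩
      u ∪ ~ (~ x ∪ x)          ≡⟨ cong (λ y → u ∪ ~ y) (trans (∪-comm _ _) (x∪~x≡y∪~y x e)) ⟩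
      u ∪ ~ ⊤                  ≡⟨ cong (u ∪_) ⊥≡~⊤ ⟨
      u ∪ ⊥                    ∎

  ∪-idem : ∀ x → x ∪ x ≡ x
  ∪-idem x = begin
    x ∪ x                ≡⟨ ~-involutive _ ⟨
    ~ ~ (x ∪ x)          ≡⟨ cong ~_ ~x≡~[x∪x] ⟨
    ~ ~ x                ≡⟨ ~-involutive x ⟩
    x                    ∎
    where
    ~x≡~[x∪x] : ~ x ≡ ~ (x ∪ x)
    ~x≡~[x∪x] = begin
      ~ x                          ≡⟨ huntington-~ x x ⟩
      ~ (x ∪ ~ x) ∪ ~ (x ∪ x)      ≡⟨ cong (λ y → ~ y ∪ ~ (x ∪ x)) (x∪~x≡y∪~y x e) ⟩
      ~ ⊤ ∪ ~ (x ∪ x)              ≡⟨ cong (_∪ ~ (x ∪ x)) ⊥≡~⊤ ⟨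
      ⊥ ∪ ~ (x ∪ x)                ≡⟨ ∪-comm _ _ ⟩
      ~ (x ∪ x) ∪ ⊥                ≡⟨ ∪-identityʳ _ ⟩
      ~ (x ∪ x)                    ∎

  _⊆_ : Rel A a
  x ⊆ y = x ∪ y ≡ y

  ⊆-refl : ∀ {x} → x ⊆ x
  ⊆-refl = ∪-idem _

  ⊆-reflexive : ∀ {x y} → x ≡ y → x ⊆ y
  ⊆-reflexive refl = ⊆-refl

  ⊆-trans : ∀ {x y z} → x ⊆ y → y ⊆ z → x ⊆ z
  ⊆-trans {x} {y} {z} x⊆y y⊆z = begin
    x ∪ z          ≡⟨ cong (x ∪_) y⊆z ⟨
    x ∪ (y ∪ z)    ≡⟨ ∪-assoc _ _ _ ⟨
    (x ∪ y) ∪ z    ≡⟨ cong (_∪ z) x⊆y ⟩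
    y ∪ z          ≡⟨ y⊆z ⟩
    z              ∎

  ⊆-antisym : ∀ {x y} → x ⊆ y → y ⊆ x → x ≡ y
  ⊆-antisym {x} {y} x⊆y y⊆x = trans (sym y⊆x) (trans (∪-comm y x) x⊆y)

  ⊆-isPreorder : IsPreorder _≡_ _⊆_
  ⊆-isPreorder = record
    { isEquivalence = isEquivalence
    ; reflexive     = ⊆-reflexive
    ; trans         = ⊆-trans
    }

  module ⊆-Reasoning where
    open DoubleReasoning ⊆-isPreorder public
    open ⊆-syntax _IsRelatedTo_ _IsRelatedTo_ ≲-go public

  x⊆x∪y : ∀ x y → x ⊆ x ∪ y
  x⊆x∪y x y = trans (sym (∪-assoc _ _ _)) (cong (_∪ y) (∪-idem x))

  y⊆x∪y : ∀ x y → y ⊆ x ∪ y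
  y⊆x∪y x y = subst (y ⊆_) (∪-comm y x) (x⊆x∪y y x)

  ∪-lub : ∀ {x y z} → x ⊆ z → y ⊆ z → x ∪ y ⊆ z
  ∪-lub {x} x⊆z y⊆z = trans (∪-assoc _ _ _) (trans (cong (x ∪_) y⊆z) x⊆z)

  ∪-mono : ∀ {x x′ y y′} → x ⊆ x′ → y ⊆ y′ → x ∪ y ⊆ x′ ∪ y′
  ∪-mono {x′ = x′} {y′ = y′} x⊆x′ y⊆y′ =
    ∪-lub (⊆-trans x⊆x′ (x⊆x∪y x′ y′)) (⊆-trans y⊆y′ (y⊆x∪y x′ y′))

  ⊥-least : ∀ x → ⊥ ⊆ x
  ⊥-least x = trans (∪-comm ⊥ x) (∪-identityʳ x)

  ⊤-greatest : ∀ x → x ⊆ ⊤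
  ⊤-greatest x = trans (∪-comm x ⊤) (∪-zeroˡ x)

  ~-antitone : ∀ {x y} → x ⊆ y → ~ y ⊆ ~ x
  ~-antitone {x} {y} x⊆y = begin
    ~ y ∪ ~ x                          ≡⟨ cong (~ y ∪_) (huntington-~ x y) ⟩
    ~ y ∪ (~ (x ∪ ~ y) ∪ ~ (x ∪ y))    ≡⟨ cong (λ z → ~ y ∪ (~ (x ∪ ~ y) ∪ ~ z)) x⊆y ⟩
    ~ y ∪ (~ (x ∪ ~ y) ∪ ~ y)          ≡⟨ y⊆x∪y (~ (x ∪ ~ y)) (~ y) ⟩
    ~ (x ∪ ~ y) ∪ ~ y                  ≡⟨ cong (~ (x ∪ ~ y) ∪_) (cong ~_ x⊆y) ⟨
    ~ (x ∪ ~ y) ∪ ~ (x ∪ y)            ≡⟨ huntington-~ x y ⟨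
    ~ x                                ∎

  ⊆~⇒⊆~ : ∀ {x y} → x ⊆ ~ y → y ⊆ ~ x
  ⊆~⇒⊆~ {x} {y} x⊆~y = subst (_⊆ ~ x) (~-involutive y) (~-antitone x⊆~y)

  x∩y⊆x : ∀ x y → x ∩ y ⊆ x
  x∩y⊆x x y = subst (x ∩ y ⊆_) (~-involutive x) (~-antitone (x⊆x∪y (~ x) (~ y)))

  x∩y⊆y : ∀ x y → x ∩ y ⊆ y
  x∩y⊆y x y = subst (x ∩ y ⊆_) (~-involutive y) (~-antitone (y⊆x∪y (~ x) (~ y)))

  ∩-glb : ∀ {x y z} → z ⊆ x → z ⊆ y → z ⊆ x ∩ y
  ∩-glb {z = z} z⊆x z⊆y =
    subst (_⊆ _) (~-involutive z) (~-antitone (∪-lub (~-antitone z⊆x) (~-antitone z⊆y)))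

  ∩-mono : ∀ {x x′ y y′} → x ⊆ x′ → y ⊆ y′ → x ∩ y ⊆ x′ ∩ y′
  ∩-mono {x} {y = y} x⊆x′ y⊆y′ = ∩-glb (⊆-trans (x∩y⊆x x y) x⊆x′) (⊆-trans (x∩y⊆y x y) y⊆y′)

  ⊆∩~⇒⊆⊥ : ∀ {x y} → x ⊆ y → x ⊆ ~ y → x ⊆ ⊥
  ⊆∩~⇒⊆⊥ {y = y} x⊆y x⊆~y =
    subst (_ ⊆_) (trans (cong ~_ (~x∪~~x≡⊤ y)) (sym ⊥≡~⊤)) (∩-glb x⊆y x⊆~y)

  x⊆x∩y∪~y : ∀ x y → x ⊆ x ∩ y ∪ ~ y
  x⊆x∩y∪~y x y = subst (_⊆ x ∩ y ∪ ~ y) (sym (huntington x y))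
    (∪-mono ⊆-refl (~-antitone (y⊆x∪y (~ x) y)))

  ∩⊆⊥⇒⊆~ : ∀ {x y} → x ∩ y ⊆ ⊥ → x ⊆ ~ y
  ∩⊆⊥⇒⊆~ {x} {y} x∩y⊆⊥ = ⊆-trans (x⊆x∩y∪~y x y)
    (subst (x ∩ y ∪ ~ y ⊆_) (trans (∪-comm _ _) (∪-identityʳ (~ y))) (∪-mono x∩y⊆⊥ ⊆-refl))

  ⊆∪~⇒∩⊆ : ∀ {x y z} → x ⊆ y ∪ ~ z → x ∩ z ⊆ y
  ⊆∪~⇒∩⊆ {x} {y} {z} x⊆y∪~z =
    subst (x ∩ z ⊆_) (~-involutive y) (∩⊆⊥⇒⊆~ (⊆∩~⇒⊆⊥ into-y∪~z into-~[y∪~z]))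
    where
    w : A
    w = (x ∩ z) ∩ ~ y
    into-y∪~z : w ⊆ y ∪ ~ z
    into-y∪~z = ⊆-trans (x∩y⊆x _ _) (⊆-trans (x∩y⊆x x z) x⊆y∪~z)
    into-~[y∪~z] : w ⊆ ~ (y ∪ ~ z)
    into-~[y∪~z] = subst (w ⊆_) (cong (λ u → ~ (u ∪ ~ z)) (~-involutive y))
      (∩-glb (x∩y⊆y _ _) (⊆-trans (x∩y⊆x _ _) (x∩y⊆y x z)))

module KleeneRelationAlgebraProperties {c} (K : KleeneRelationAlgebra c) where
  open KleeneRelationAlgebra K public

  huntingtonAlgebra : HuntingtonAlgebra c
  huntingtonAlgebra = record
    { Carrier    = B
    ; _∪_        = _∪_
    ; ~_         = ~_
    ; ∪-assoc    = ∪-assoc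
    ; ∪-comm     = ∪-comm
    ; huntington = huntington
    }

  open HuntingtonAlgebraProperties huntingtonAlgebra I public
    hiding (_⊆_; _∩_; ⊤; ⊥)
    renaming (⊤-greatest to L-greatest; ⊥-least to O-least; ~⊥≡⊤ to ~O≡L;
              ⊆∩~⇒⊆⊥ to ⊆∩~⇒⊆O; ∩⊆⊥⇒⊆~ to ∩⊆O⇒⊆~)
  open ⊆-Reasoning

  ᵀ-injective : ∀ {R S} → R ᵀ ≡ S ᵀ → R ≡ S
  ᵀ-injective {R} {S} Rᵀ≡Sᵀ = trans (sym (ᵀ-involutive R)) (trans (cong _ᵀ Rᵀ≡Sᵀ) (ᵀ-involutive S))

  ᵀ-mono : ∀ {R S} → R ⊆ S → R ᵀ ⊆ S ᵀ
  ᵀ-mono {R} {S} R⊆S = trans (sym (ᵀ-∪ R S)) (cong _ᵀ R⊆S)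

  ᵀ-reflects-⊆ : ∀ {R S} → R ᵀ ⊆ S ᵀ → R ⊆ S
  ᵀ-reflects-⊆ {R} {S} = subst₂ _⊆_ (ᵀ-involutive R) (ᵀ-involutive S) ∘ ᵀ-mono

  ᵀ-identity : I ᵀ ≡ I
  ᵀ-identity = begin-equality
    I ᵀ              ≡⟨ ⨾-identityʳ (I ᵀ) ⟨
    I ᵀ ⨾ I          ≡⟨ cong (I ᵀ ⨾_) (ᵀ-involutive I) ⟨
    I ᵀ ⨾ (I ᵀ) ᵀ    ≡⟨ ᵀ-⨾ (I ᵀ) I ⟨
    (I ᵀ ⨾ I) ᵀ      ≡⟨ cong _ᵀ (⨾-identityʳ (I ᵀ)) ⟩
    (I ᵀ) ᵀ          ≡⟨ ᵀ-involutive I ⟩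
    I                ∎

  ⨾-identityˡ : ∀ R → I ⨾ R ≡ R
  ⨾-identityˡ R = ᵀ-injective (begin-equality
    (I ⨾ R) ᵀ        ≡⟨ ᵀ-⨾ I R ⟩
    R ᵀ ⨾ I ᵀ        ≡⟨ cong (R ᵀ ⨾_) ᵀ-identity ⟩
    R ᵀ ⨾ I          ≡⟨ ⨾-identityʳ (R ᵀ) ⟩
    R ᵀ              ∎)

  ⨾-distribˡ : ∀ T R S → T ⨾ (R ∪ S) ≡ T ⨾ R ∪ T ⨾ S
  ⨾-distribˡ T R S = ᵀ-injective (begin-equality
    (T ⨾ (R ∪ S)) ᵀ              ≡⟨ ᵀ-⨾ T (R ∪ S) ⟩
    (R ∪ S) ᵀ ⨾ T ᵀ              ≡⟨ cong (_⨾ T ᵀ) (ᵀ-∪ R S) ⟩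
    (R ᵀ ∪ S ᵀ) ⨾ T ᵀ            ≡⟨ ⨾-distribʳ (R ᵀ) (S ᵀ) (T ᵀ) ⟩
    R ᵀ ⨾ T ᵀ ∪ S ᵀ ⨾ T ᵀ        ≡⟨ cong₂ _∪_ (ᵀ-⨾ T R) (ᵀ-⨾ T S) ⟨
    (T ⨾ R) ᵀ ∪ (T ⨾ S) ᵀ        ≡⟨ ᵀ-∪ (T ⨾ R) (T ⨾ S) ⟨
    (T ⨾ R ∪ T ⨾ S) ᵀ            ∎)

  ⨾-monoˡ : ∀ {R S} T → R ⊆ S → R ⨾ T ⊆ S ⨾ T
  ⨾-monoˡ {R} {S} T R⊆S = trans (sym (⨾-distribʳ R S T)) (cong (_⨾ T) R⊆S)

  ⨾-monoʳ : ∀ T {R S} → R ⊆ S → T ⨾ R ⊆ T ⨾ S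
  ⨾-monoʳ T {R} {S} R⊆S = trans (sym (⨾-distribˡ T R S)) (cong (T ⨾_) R⊆S)

  R⊆R⨾L : ∀ R → R ⊆ R ⨾ L
  R⊆R⨾L R = subst (_⊆ R ⨾ L) (⨾-identityʳ R) (⨾-monoʳ R (L-greatest I))

  ᵀ-∩ : ∀ R S → (R ∩ S) ᵀ ≡ R ᵀ ∩ S ᵀ
  ᵀ-∩ R S = ⊆-antisym (ᵀ-∩-⊆ R S) (ᵀ-reflects-⊆ (begin
    (R ᵀ ∩ S ᵀ) ᵀ          ⊆⟨ ᵀ-∩-⊆ (R ᵀ) (S ᵀ) ⟩
    (R ᵀ) ᵀ ∩ (S ᵀ) ᵀ      ≡⟨ cong₂ _∩_ (ᵀ-involutive R) (ᵀ-involutive S) ⟩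
    R ∩ S                  ≡⟨ ᵀ-involutive (R ∩ S) ⟨
    ((R ∩ S) ᵀ) ᵀ          ∎))
    where
    ᵀ-∩-⊆ : ∀ X Y → (X ∩ Y) ᵀ ⊆ X ᵀ ∩ Y ᵀ
    ᵀ-∩-⊆ X Y = ∩-glb (ᵀ-mono (x∩y⊆x X Y)) (ᵀ-mono (x∩y⊆y X Y))

  schroeder-⊆ : ∀ {R S T} → R ⨾ S ⊆ T → R ᵀ ⨾ ~ T ⊆ ~ S
  schroeder-⊆ {R} {S} R⨾S⊆T = ⊆-trans (⨾-monoʳ (R ᵀ) (~-antitone R⨾S⊆T)) (schroeder R S)

  schroeder-⊆ᵀ : ∀ R S → R ⨾ ~ (R ᵀ ⨾ S) ⊆ ~ S
  schroeder-⊆ᵀ R S = subst (λ X → X ⨾ ~ (R ᵀ ⨾ S) ⊆ ~ S) (ᵀ-involutive R) (schroeder (R ᵀ) S)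

  modularˡ : ∀ Q S T → Q ⨾ S ∩ T ⊆ Q ⨾ (S ∩ Q ᵀ ⨾ T)
  modularˡ Q S T = ⊆∪~⇒∩⊆ (begin
    Q ⨾ S                                  ⊆⟨ ⨾-monoʳ Q (x⊆x∩y∪~y S (Q ᵀ ⨾ T)) ⟩
    Q ⨾ (S ∩ Q ᵀ ⨾ T ∪ ~ (Q ᵀ ⨾ T))        ≡⟨ ⨾-distribˡ Q _ _ ⟩
    Q ⨾ (S ∩ Q ᵀ ⨾ T) ∪ Q ⨾ ~ (Q ᵀ ⨾ T)    ⊆⟨ ∪-mono ⊆-refl (schroeder-⊆ᵀ Q T) ⟩
    Q ⨾ (S ∩ Q ᵀ ⨾ T) ∪ ~ T                ∎)

  modularʳ : ∀ Q S T → Q ⨾ S ∩ T ⊆ (Q ∩ T ⨾ S ᵀ) ⨾ S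
  modularʳ Q S T = ᵀ-reflects-⊆ (begin
    (Q ⨾ S ∩ T) ᵀ                      ≡⟨ ᵀ-∩ (Q ⨾ S) T ⟩
    (Q ⨾ S) ᵀ ∩ T ᵀ                    ≡⟨ cong (_∩ T ᵀ) (ᵀ-⨾ Q S) ⟩
    S ᵀ ⨾ Q ᵀ ∩ T ᵀ                    ⊆⟨ modularˡ (S ᵀ) (Q ᵀ) (T ᵀ) ⟩
    S ᵀ ⨾ (Q ᵀ ∩ (S ᵀ) ᵀ ⨾ T ᵀ)        ≡⟨ cong (λ X → S ᵀ ⨾ (Q ᵀ ∩ X)) (ᵀ-⨾ T (S ᵀ)) ⟨
    S ᵀ ⨾ (Q ᵀ ∩ (T ⨾ S ᵀ) ᵀ)          ≡⟨ cong (S ᵀ ⨾_) (ᵀ-∩ Q (T ⨾ S ᵀ)) ⟨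
    S ᵀ ⨾ (Q ∩ T ⨾ S ᵀ) ᵀ              ≡⟨ ᵀ-⨾ (Q ∩ T ⨾ S ᵀ) S ⟨
    ((Q ∩ T ⨾ S ᵀ) ⨾ S) ᵀ              ∎)

  I⊆R* : ∀ R → I ⊆ R *
  I⊆R* R = ⊆-trans (x⊆x∪y I (R ⨾ R *)) (star-unfoldˡ R)

  R*⨾R⊆R* : ∀ R → R * ⨾ R ⊆ R *
  R*⨾R⊆R* R = ⊆-trans (y⊆x∪y I (R * ⨾ R)) (star-unfoldʳ R)

  R⨾R*⊆R* : ∀ R → R ⨾ R * ⊆ R *
  R⨾R*⊆R* R = ⊆-trans (y⊆x∪y I (R ⨾ R *)) (star-unfoldˡ R)

  R⊆R*⨾R : ∀ R → R ⊆ R * ⨾ R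
  R⊆R*⨾R R = subst (_⊆ R * ⨾ R) (⨾-identityˡ R) (⨾-monoˡ R (I⊆R* R))

  R⊆R⁺ : ∀ R → R ⊆ R ⁺
  R⊆R⁺ R = subst (_⊆ R ⁺) (⨾-identityʳ R) (⨾-monoʳ R (I⊆R* R))

  R⁺≡R*⨾R : ∀ R → R ⁺ ≡ R * ⨾ R
  R⁺≡R*⨾R R = ⊆-antisym
    (star-inductʳ R R (R * ⨾ R) (∪-lub (R⊆R*⨾R R) (⨾-monoˡ R (R*⨾R⊆R* R))))
    (star-inductˡ R R (R ⁺) (∪-lub (R⊆R⁺ R) (⨾-monoʳ R (R⨾R*⊆R* R))))

  R⨾R⁺≡R⁺⨾R : ∀ R → R ⨾ R ⁺ ≡ R ⁺ ⨾ R
  R⨾R⁺≡R⁺⨾R R = trans (cong (R ⨾_) (R⁺≡R*⨾R R)) (sym (⨾-assoc R (R *) R))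

  *-ᵀ : ∀ R → (R *) ᵀ ≡ (R ᵀ) *
  *-ᵀ R = ⊆-antisym (*-ᵀ-⊆ R) (begin
    (R ᵀ) *                ≡⟨ ᵀ-involutive _ ⟨
    (((R ᵀ) *) ᵀ) ᵀ        ⊆⟨ ᵀ-mono (*-ᵀ-⊆ (R ᵀ)) ⟩
    (((R ᵀ) ᵀ) *) ᵀ        ≡⟨ cong (λ X → (X *) ᵀ) (ᵀ-involutive R) ⟩
    (R *) ᵀ                ∎)
    where
    *-ᵀ-⊆ : ∀ X → (X *) ᵀ ⊆ (X ᵀ) *
    *-ᵀ-⊆ X = subst ((X *) ᵀ ⊆_) (ᵀ-involutive _) (ᵀ-mono (begin
      X *                  ≡⟨ ⨾-identityʳ (X *) ⟨
      X * ⨾ I              ⊆⟨ star-inductˡ X I (((X ᵀ) *) ᵀ) (∪-lub I⊆[Xᵀ*]ᵀ X⨾[Xᵀ*]ᵀ⊆[Xᵀ*]ᵀ) ⟩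
      ((X ᵀ) *) ᵀ          ∎))
      where
      I⊆[Xᵀ*]ᵀ : I ⊆ ((X ᵀ) *) ᵀ
      I⊆[Xᵀ*]ᵀ = subst (_⊆ ((X ᵀ) *) ᵀ) ᵀ-identity (ᵀ-mono (I⊆R* (X ᵀ)))
      X⨾[Xᵀ*]ᵀ⊆[Xᵀ*]ᵀ : X ⨾ ((X ᵀ) *) ᵀ ⊆ ((X ᵀ) *) ᵀ
      X⨾[Xᵀ*]ᵀ⊆[Xᵀ*]ᵀ = subst (_⊆ ((X ᵀ) *) ᵀ) (trans (ᵀ-⨾ _ _) (cong (_⨾ ((X ᵀ) *) ᵀ) (ᵀ-involutive X)))
              (ᵀ-mono (R*⨾R⊆R* (X ᵀ)))

  onCycle : B → B
  onCycle R = (R ⁺ ∩ I) ⨾ L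

  R⁺∩I⊆Rᵀ⨾R : ∀ R → R ⁺ ∩ I ⊆ R ᵀ ⨾ R
  R⁺∩I⊆Rᵀ⨾R R = begin
    R ⁺ ∩ I                  ≡⟨ cong (_∩ I) (R⁺≡R*⨾R R) ⟩
    R * ⨾ R ∩ I              ⊆⟨ modularʳ (R *) R I ⟩
    (R * ∩ I ⨾ R ᵀ) ⨾ R      ⊆⟨ ⨾-monoˡ R (x∩y⊆y (R *) (I ⨾ R ᵀ)) ⟩
    I ⨾ R ᵀ ⨾ R              ≡⟨ cong (_⨾ R) (⨾-identityˡ (R ᵀ)) ⟩
    R ᵀ ⨾ R                  ∎

  injective⇒R⨾[R⁺∩I]⊆[R⁺∩I]⨾R : ∀ {R} → Injective R → R ⨾ (R ⁺ ∩ I) ⊆ (R ⁺ ∩ I) ⨾ R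
  injective⇒R⨾[R⁺∩I]⊆[R⁺∩I]⨾R {R} injective = begin
    R ⨾ (R ⁺ ∩ I)            ⊆⟨ ∩-glb (⨾-monoʳ R (x∩y⊆x (R ⁺) I)) (⨾-monoʳ R (x∩y⊆y (R ⁺) I)) ⟩
    R ⨾ R ⁺ ∩ R ⨾ I          ≡⟨ cong₂ _∩_ (R⨾R⁺≡R⁺⨾R R) (⨾-identityʳ R) ⟩
    R ⁺ ⨾ R ∩ R              ⊆⟨ modularʳ (R ⁺) R R ⟩
    (R ⁺ ∩ R ⨾ R ᵀ) ⨾ R      ⊆⟨ ⨾-monoˡ R (∩-mono ⊆-refl injective) ⟩
    (R ⁺ ∩ I) ⨾ R            ∎

  injective⇒R⨾onCycle⊆onCycle : ∀ {R} → Injective R → R ⨾ onCycle R ⊆ onCycle R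
  injective⇒R⨾onCycle⊆onCycle {R} injective = begin
    R ⨾ ((R ⁺ ∩ I) ⨾ L)      ≡⟨ ⨾-assoc R (R ⁺ ∩ I) L ⟨
    R ⨾ (R ⁺ ∩ I) ⨾ L        ⊆⟨ ⨾-monoˡ L (injective⇒R⨾[R⁺∩I]⊆[R⁺∩I]⨾R injective) ⟩
    (R ⁺ ∩ I) ⨾ R ⨾ L        ≡⟨ ⨾-assoc (R ⁺ ∩ I) R L ⟩
    (R ⁺ ∩ I) ⨾ (R ⨾ L)      ⊆⟨ ⨾-monoʳ (R ⁺ ∩ I) (L-greatest (R ⨾ L)) ⟩
    (R ⁺ ∩ I) ⨾ L            ∎

  onCycle⊆Rᵀ⨾L : ∀ R → onCycle R ⊆ R ᵀ ⨾ L
  onCycle⊆Rᵀ⨾L R = begin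
    (R ⁺ ∩ I) ⨾ L            ⊆⟨ ⨾-monoˡ L (R⁺∩I⊆Rᵀ⨾R R) ⟩
    R ᵀ ⨾ R ⨾ L              ≡⟨ ⨾-assoc (R ᵀ) R L ⟩
    R ᵀ ⨾ (R ⨾ L)            ⊆⟨ ⨾-monoʳ (R ᵀ) (L-greatest (R ⨾ L)) ⟩
    R ᵀ ⨾ L                  ∎

  R⨾p≡O⇒Rᵀ⨾L⊆~p : ∀ {R p} → R ⨾ p ≡ O → R ᵀ ⨾ L ⊆ ~ p
  R⨾p≡O⇒Rᵀ⨾L⊆~p {R} R⨾p≡O =
    subst (λ X → R ᵀ ⨾ X ⊆ _) ~O≡L (schroeder-⊆ (⊆-reflexive R⨾p≡O))

  R⨾p≡O⇒R*⨾p⊆p : ∀ {R p} → R ⨾ p ≡ O → R * ⨾ p ⊆ p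
  R⨾p≡O⇒R*⨾p⊆p {R} {p} R⨾p≡O =
    star-inductˡ R p p (∪-lub ⊆-refl (subst (_⊆ p) (sym R⨾p≡O) (O-least p)))

  Rᵀ⨾L⊆Rᵀ*⨾p : ∀ {R p} → IsPoint p → p ⨾ R ⊆ R * ∪ (R ᵀ) * → R ⨾ p ≡ O →
                R ᵀ ⨾ L ⊆ (R ᵀ) * ⨾ p
  Rᵀ⨾L⊆Rᵀ*⨾p {R} {p} (p≡p⨾L , _ , I⊆pᵀ⨾p) p⨾R⊆ R⨾p≡O = begin
    R ᵀ ⨾ L                              ⊆⟨ ⨾-monoˡ L Rᵀ⊆Rᵀ*⨾p ⟩
    (R ᵀ) * ⨾ p ⨾ L                      ≡⟨ trans (⨾-assoc _ p L) (cong ((R ᵀ) * ⨾_) (sym p≡p⨾L)) ⟩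
    (R ᵀ) * ⨾ p                          ∎
    where
    p⊆Rᵀ*⨾p : p ⊆ (R ᵀ) * ⨾ p
    p⊆Rᵀ*⨾p = subst (_⊆ (R ᵀ) * ⨾ p) (⨾-identityˡ p) (⨾-monoˡ p (I⊆R* (R ᵀ)))
    Rᵀ⊆Rᵀ*⨾p : R ᵀ ⊆ (R ᵀ) * ⨾ p
    Rᵀ⊆Rᵀ*⨾p = begin
      R ᵀ                                ≡⟨ ⨾-identityʳ (R ᵀ) ⟨
      R ᵀ ⨾ I                            ⊆⟨ ⨾-monoʳ (R ᵀ) I⊆pᵀ⨾p ⟩
      R ᵀ ⨾ (p ᵀ ⨾ p)                    ≡⟨ trans (sym (⨾-assoc _ _ _)) (cong (_⨾ p) (sym (ᵀ-⨾ p R))) ⟩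
      (p ⨾ R) ᵀ ⨾ p                      ⊆⟨ ⨾-monoˡ p (ᵀ-mono p⨾R⊆) ⟩
      (R * ∪ (R ᵀ) *) ᵀ ⨾ p              ≡⟨ cong (_⨾ p) (ᵀ-∪ (R *) ((R ᵀ) *)) ⟩
      ((R *) ᵀ ∪ ((R ᵀ) *) ᵀ) ⨾ p        ≡⟨ cong (λ X → ((R *) ᵀ ∪ X) ⨾ p) (trans (*-ᵀ (R ᵀ)) (cong _* (ᵀ-involutive R))) ⟩
      ((R *) ᵀ ∪ R *) ⨾ p                ≡⟨ cong (λ X → (X ∪ R *) ⨾ p) (*-ᵀ R) ⟩
      ((R ᵀ) * ∪ R *) ⨾ p                ≡⟨ ⨾-distribʳ ((R ᵀ) *) (R *) p ⟩
      (R ᵀ) * ⨾ p ∪ R * ⨾ p              ⊆⟨ ∪-lub ⊆-refl (⊆-trans (R⨾p≡O⇒R*⨾p⊆p R⨾p≡O) p⊆Rᵀ*⨾p) ⟩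
      (R ᵀ) * ⨾ p                        ∎

  R⨾C⊆C⇒Rᵀ*⨾p⊆~C : ∀ {R C p} → R ⨾ C ⊆ C → p ⊆ ~ C → (R ᵀ) * ⨾ p ⊆ ~ C
  R⨾C⊆C⇒Rᵀ*⨾p⊆~C {R} {C} {p} R⨾C⊆C p⊆~C =
    star-inductˡ (R ᵀ) p (~ C) (∪-lub p⊆~C (schroeder-⊆ R⨾C⊆C))

mainTheorem15 : ∀ {c : Level} (K : KleeneRelationAlgebra c) →
    let open KleeneRelationAlgebra K in
    ∀ (R p : B) → Injective R → Univalent R → IsPoint p →
    p ⨾ R ⊆ R * ∪ (R ᵀ) * → R ⨾ p ≡ O →
    R ⁺ ⊆ ~ I
mainTheorem15 K R p injective _ point p⨾R⊆ R⨾p≡O =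
  ∩⊆O⇒⊆~ (⊆-trans (R⊆R⨾L (R ⁺ ∩ I)) (⊆∩~⇒⊆O ⊆-refl onCycle⊆~onCycle))
  where
  open KleeneRelationAlgebraProperties K
  open ⊆-Reasoning
  onCycle⊆~onCycle : onCycle R ⊆ ~ onCycle R
  onCycle⊆~onCycle = begin
    onCycle R           ⊆⟨ onCycle⊆Rᵀ⨾L R ⟩
    R ᵀ ⨾ L             ⊆⟨ Rᵀ⨾L⊆Rᵀ*⨾p point p⨾R⊆ R⨾p≡O ⟩
    (R ᵀ) * ⨾ p         ⊆⟨ R⨾C⊆C⇒Rᵀ*⨾p⊆~C (injective⇒R⨾onCycle⊆onCycle injective)
                             (⊆~⇒⊆~ (⊆-trans (onCycle⊆Rᵀ⨾L R) (R⨾p≡O⇒Rᵀ⨾L⊆~p R⨾p≡O))) ⟩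
    ~ onCycle R         ∎
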